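{- The real-order preserving approximate order $(\le^n_K)_{n\in\mathbb{N}}$ on $K:=\{\bar1,0,1\}^{\mathbb{N}}$ is an approximate linear preorder on the discrete-sequence closeness space $K$.
   Context: Constructive type theory. Ternary digits $\{\bar1,0,1\}$. For $\alpha,\beta\in K$, $\alpha\sim^n\beta$ means $\alpha_i=\beta_i$ for all $i<n$. $\mathbb{N}_\infty$: decreasing binary sequences; $\underline{n}$: $n$ ones then zeros; $u\preceq v$ iff $\forall n(u_n=1\Rightarrow v_n=1)$. The discrete-sequence closeness function on $K$ is $c(\alpha,\beta)_n=1$ if $\alpha\sim^{n+1}\beta$ and $0$ otherwise; $C_\varepsilon(\alpha,\beta)$ means $\underline{\varepsilon}\preceq c(\alpha,\beta)$. Let $\mathrm{down}(\bar1)(k)=2k$, $\mathrm{down}(0)(k)=2k+1$, $\mathrm{down}(1)(k)=2k+2$ for $k\in\mathbb{Z}$. Define $a:\mathbb{Z}\to K\to\mathbb{N}\to\mathbb{Z}$ by $a(k,\alpha,0)=k$ and $a(k,\alpha,n+1)=a(\mathrm{down}(\alpha_0)(k),\mathrm{tail}\,\alpha,n)$, and $\mathrm{integerApprox}(\alpha)_n:=a(-1,\alpha,n)$. Then $\alpha\le^n_K\beta$ iff $\mathrm{integerApprox}(\alpha)_n\le\mathrm{integerApprox}(\beta)_n$ in $\mathbb{Z}$. An approximate linear preorder on a closeness space $Y$ is a family of proposition-valued relations $\le^\varepsilon$ such that each $\le^\varepsilon$ is reflexive, transitive, linear (for all $x,y$ one can decide which of $x\le^\varepsilon y$, $y\le^\varepsilon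 x$ holds), decidable, and $C_\varepsilon(x,y)\Rightarrow x\le^\varepsilon y$. -}

module Defs where

open import Data.Nat using (ℕ; zero; suc)
open import Data.Bool using (Bool; true; false)
open import Data.Integer using (ℤ; _+_; _*_; _≤_; +_; -[1+_])
open import Data.Fin using (Fin; toℕ)
open import Data.Product using (Σ; _×_)
open import Data.Sum using (_⊎_)
open import Relation.Nullary using (Dec)
open import Relation.Binary.PropositionalEquality using (_≡_)
open import Level using (Level; _⊔_) renaming (suc to lsuc)

data 𝟛 : Set where
  −1 O +1 : 𝟛

K : Set
K = ℕ → 𝟛

tail : {A : Set} → (ℕ → A) → ℕ → A
tail α n = α (suc n)

_∼⟨_⟩_ : K → ℕ → K → Set
α ∼⟨ n ⟩ β = (i : Fin n) → α (toℕ i) ≡ β (toℕ i)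

decreasing : (ℕ → Bool) → Set
decreasing u = (n : ℕ) → u (suc n) ≡ true → u n ≡ true

ℕ∞ : Set
ℕ∞ = Σ (ℕ → Bool) decreasing

seq : ℕ∞ → ℕ → Bool
seq u = Data.Product.proj₁ u

_≼_ : ℕ∞ → ℕ∞ → Set
u ≼ v = (n : ℕ) → seq u n ≡ true → seq v n ≡ true

under-seq : ℕ → ℕ → Bool
under-seq zero    _       = false
under-seq (suc n) zero    = true
under-seq (suc n) (suc i) = under-seq n i

under-dec : (n : ℕ) → decreasing (under-seq n)
under-dec zero    i       ()
under-dec (suc n) zero    _ = Relation.Binary.PropositionalEquality.refl
under-dec (suc n) (suc i) p = under-dec n i p

under : ℕ → ℕ∞
under n = under-seq n Data.Product., under-dec n

record ClosenessSpace : Set₁ where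
  field
    ⟨_⟩ : Set
    c   : ⟨_⟩ → ⟨_⟩ → ℕ∞

C : (X : ClosenessSpace) → ℕ → ClosenessSpace.⟨ X ⟩ → ClosenessSpace.⟨ X ⟩ → Set
C X ε x y = under ε ≼ ClosenessSpace.c X x y

-- Discrete-sequence closeness on K:
-- c(α,β)_n = 1 if α ∼^{n+1} β, and 0 otherwise.
-- Computed as the ℕ∞ element: agreement of the first n+1 digits.
_=𝟛?_ : 𝟛 → 𝟛 → Bool
−1 =𝟛? −1 = true
O  =𝟛? O  = true
+1 =𝟛? +1 = true
_  =𝟛? _  = false

infixr 6 _∧_
_∧_ : Bool → Bool → Bool
true ∧ b = b
false ∧ _ = false

agree : K → K → ℕ → Bool
agree α β zero    = α 0 =𝟛? β 0
agree α β (suc n) = (α 0 =𝟛? β 0) ∧ agree (tail α) (tail β) n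

agree-dec : (α β : K) → decreasing (agree α β)
agree-dec α β zero p with α 0 =𝟛? β 0
... | true  = Relation.Binary.PropositionalEquality.refl
... | false = p
agree-dec α β (suc n) p with α 0 =𝟛? β 0
... | true  = agree-dec (tail α) (tail β) n p
... | false = p

cK : K → K → ℕ∞
cK α β = agree α β Data.Product., agree-dec α β

KSpace : ClosenessSpace
KSpace = record { ⟨_⟩ = K ; c = cK }

down : 𝟛 → ℤ → ℤ
down −1 k = (+ 2) * k
down O  k = (+ 2) * k + + 1
down +1 k = (+ 2) * k + + 2

a : ℤ → K → ℕ → ℤ
a k α zero    = k
a k α (suc n) = a (down (α 0) k) (tail α) n

integerApprox : K → ℕ → ℤ
integerApprox α n = a -[1+ 0 ] α n

_≤K⟨_⟩_ : K → ℕ → K → Set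
α ≤K⟨ n ⟩ β = integerApprox α n ≤ integerApprox β n

is-prop : Set → Set
is-prop P = (p q : P) → p ≡ q

record IsApproxLinearPreorder (X : ClosenessSpace)
    (_≤⟨_⟩_ : ClosenessSpace.⟨ X ⟩ → ℕ → ClosenessSpace.⟨ X ⟩ → Set) : Set where
  open ClosenessSpace X
  field
    prop-valued : (ε : ℕ) (x y : ⟨_⟩) → is-prop (x ≤⟨ ε ⟩ y)
    reflexive   : (ε : ℕ) (x : ⟨_⟩) → x ≤⟨ ε ⟩ x
    transitive  : (ε : ℕ) (x y z : ⟨_⟩) → x ≤⟨ ε ⟩ y → y ≤⟨ ε ⟩ z → x ≤⟨ ε ⟩ z
    linear      : (ε : ℕ) (x y : ⟨_⟩) → (x ≤⟨ ε ⟩ y) ⊎ (y ≤⟨ ε ⟩ x)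
    decidable   : (ε : ℕ) (x y : ⟨_⟩) → Dec (x ≤⟨ ε ⟩ y)
    close⇒≤     : (ε : ℕ) (x y : ⟨_⟩) → C X ε x y → x ≤⟨ ε ⟩ y

-- Pulling back the decidable total order of ℤ along ε-indexed integer
-- approximations gives all preorder axioms at once; closeness is respected
-- because ε-close sequences share their first ε digits, which are the only
-- digits a(k, α, ε) reads.
module Submission where

open import Defs
open import Data.Nat using (ℕ; zero; suc)
open import Data.Bool using (Bool; true; false)
open import Data.Integer using (ℤ; _≤_)
open import Data.Integer.Properties
  using (≤-irrelevant; ≤-refl; ≤-trans; ≤-total; _≤?_; ≤-reflexive)
open import Relation.Binary.PropositionalEquality using (_≡_; refl; subst)

=𝟛?⇒≡ : (x y : 𝟛) → (x =𝟛? y) ≡ true → x ≡ y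
=𝟛?⇒≡ −1 −1 _ = refl
=𝟛?⇒≡ O  O  _ = refl
=𝟛?⇒≡ +1 +1 _ = refl
=𝟛?⇒≡ −1 O  ()
=𝟛?⇒≡ −1 +1 ()
=𝟛?⇒≡ O  −1 ()
=𝟛?⇒≡ O  +1 ()
=𝟛?⇒≡ +1 −1 ()
=𝟛?⇒≡ +1 O  ()

∧≡true⇒ʳ : (b c : Bool) → b ∧ c ≡ true → c ≡ true
∧≡true⇒ʳ true  c p = p
∧≡true⇒ʳ false c ()

C-head : (ε : ℕ) (α β : K) → C KSpace (suc ε) α β → α 0 ≡ β 0
C-head ε α β h = =𝟛?⇒≡ (α 0) (β 0) (h 0 refl)

C-tail : (ε : ℕ) (α β : K) → C KSpace (suc ε) α β → C KSpace ε (tail α) (tail β)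
C-tail ε α β h n p = ∧≡true⇒ʳ (α 0 =𝟛? β 0) _ (h (suc n) p)

a-cong-C : (ε : ℕ) (k : ℤ) (α β : K) → C KSpace ε α β → a k α ε ≡ a k β ε
a-cong-C zero    k α β h = refl
a-cong-C (suc ε) k α β h =
  subst (λ d → a (down (α 0) k) (tail α) ε ≡ a (down d k) (tail β) ε)
        (C-head ε α β h)
        (a-cong-C ε (down (α 0) k) (tail α) (tail β) (C-tail ε α β h))

integerApprox-cong-C : (ε : ℕ) (α β : K) →
  C KSpace ε α β → integerApprox α ε ≡ integerApprox β ε
integerApprox-cong-C ε = a-cong-C ε _

approxLinearPreorder-from-ℤ : (X : ClosenessSpace)
  (f : ClosenessSpace.⟨ X ⟩ → ℕ → ℤ) →
  ((ε : ℕ) (x y : ClosenessSpace.⟨ X ⟩) → C X ε x y → f x ε ≡ f y ε) →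
  IsApproxLinearPreorder X (λ x ε y → f x ε ≤ f y ε)
approxLinearPreorder-from-ℤ X f f-cong = record
  { prop-valued = λ ε x y → ≤-irrelevant
  ; reflexive   = λ ε x → ≤-refl
  ; transitive  = λ ε x y z → ≤-trans
  ; linear      = λ ε x y → ≤-total (f x ε) (f y ε)
  ; decidable   = λ ε x y → f x ε ≤? f y ε
  ; close⇒≤     = λ ε x y h → ≤-reflexive (f-cong ε x y h)
  }

lemma6p10 : IsApproxLinearPreorder KSpace _≤K⟨_⟩_
lemma6p10 = approxLinearPreorder-from-ℤ KSpace integerApprox integerApprox-cong-C
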